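{- For an integer $k\ge2$, let $\widehat G_k$ be the graph with vertex set $\mathbb{N}\times\mathbb{N}$ in which $(x,y)$ and $(x',y')$ are adjacent iff either $x=x'$ and $|y-y'|=1$, or $x\ne x'$ and $y\not\equiv y' \pmod k$; and let $\widehat Q_k$ be the subgraph of $\widehat G_k$ induced on $\{(n,m): m<n+5\}$. Then for each $k\ge2$, $\widehat Q_k$ is path-minimal, and for distinct $k,k'\ge 2$ the ages of $\widehat Q_k$ and $\widehat Q_{k'}$ are incomparable with respect to set inclusion.
   Context: The age of a graph is the class of finite graphs (up to isomorphism) isomorphic to induced subgraphs of it. A path is a graph whose vertices can be injectively mapped into an interval of $\mathbb{Z}$ so that adjacency means images differing by $1$; its length is its number of vertices minus one. A graph $G$ is path-minimal if for every $n$ it has an induced subgraph which is a finite path of length at least $n$, and every induced subgraph of $G$ with this property contains an induced subgraph isomorphic to $G$. -}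

module Defs where

open import Data.Nat using (ℕ; zero; suc; _+_; _<_; _≤_; ∣_-_∣)
open import Data.Nat.Divisibility using (_∣_)
open import Data.Fin using (Fin; toℕ)
open import Data.Product using (Σ; _×_; _,_; proj₁; proj₂; ∃; ∃-syntax)
open import Data.Sum using (_⊎_; inj₁; inj₂)
open import Data.Empty using (⊥)
open import Relation.Nullary using (¬_)
open import Relation.Binary.PropositionalEquality using (_≡_; refl; sym; trans; cong)

record Graph : Set₁ where
  field
    V      : Set
    Adj    : V → V → Set
    sym'   : ∀ {a b} → Adj a b → Adj b a
    irrefl : ∀ {a} → ¬ Adj a a
open Graph public

Induced : (G : Graph) → (V G → Set) → Graph
Induced G P = record
  { V      = Σ (V G) P
  ; Adj    = λ a b → Adj G (proj₁ a) (proj₁ b)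
  ; sym'   = sym' G
  ; irrefl = irrefl G
  }

-- An embedding of G into H: an injective map preserving and reflecting adjacency,
-- i.e. an isomorphism of G onto an induced subgraph of H (its image).
record Embedding (G H : Graph) : Set where
  field
    f     : V G → V H
    inj   : ∀ {a b} → f a ≡ f b → a ≡ b
    pres  : ∀ {a b} → Adj G a b → Adj H (f a) (f b)
    refl' : ∀ {a b} → Adj H (f a) (f b) → Adj G a b

Embeds : Graph → Graph → Set
Embeds G H = Embedding G H

diff1 : ℕ → ℕ → Set
diff1 i j = (i ≡ suc j) ⊎ (j ≡ suc i)

diff1-sym : ∀ {i j} → diff1 i j → diff1 j i
diff1-sym (inj₁ p) = inj₂ p
diff1-sym (inj₂ p) = inj₁ p

diff1-irr : ∀ {i} → ¬ diff1 i i
diff1-irr {zero} (inj₁ ())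
diff1-irr {zero} (inj₂ ())
diff1-irr {suc i} (inj₁ p) = diff1-irr {i} (inj₁ (cong pred' p))
  where pred' : ℕ → ℕ
        pred' zero = zero
        pred' (suc n) = n
diff1-irr {suc i} (inj₂ p) = diff1-irr {i} (inj₂ (cong pred' p))
  where pred' : ℕ → ℕ
        pred' zero = zero
        pred' (suc n) = n

PathGraph : ℕ → Graph
PathGraph m = record
  { V      = Fin (suc m)
  ; Adj    = λ i j → diff1 (toℕ i) (toℕ j)
  ; sym'   = diff1-sym
  ; irrefl = λ {a} → diff1-irr {toℕ a}
  }

HasArbitrarilyLongPaths : Graph → Set
HasArbitrarilyLongPaths G = ∀ (n : ℕ) → ∃[ m ] (n ≤ m × Embeds (PathGraph m) G)

PathMinimal : Graph → Set₁
PathMinimal G =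
  HasArbitrarilyLongPaths G ×
  (∀ (P : V G → Set) → HasArbitrarilyLongPaths (Induced G P) → Embeds G (Induced G P))

record FiniteGraph : Set₁ where
  field
    size  : ℕ
    Adjf  : Fin size → Fin size → Set
    symf  : ∀ {a b} → Adjf a b → Adjf b a
    irrf  : ∀ {a} → ¬ Adjf a a

toGraph : FiniteGraph → Graph
toGraph F = record
  { V = Fin (FiniteGraph.size F) ; Adj = FiniteGraph.Adjf F
  ; sym' = FiniteGraph.symf F ; irrefl = FiniteGraph.irrf F }

-- Membership in the age of G (finite graph up to isomorphism ≅ induced subgraph).
InAge : Graph → FiniteGraph → Set
InAge G F = Embeds (toGraph F) G

AgeSubset : Graph → Graph → Set₁
AgeSubset G H = ∀ (F : FiniteGraph) → InAge G F → InAge H F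

_≡[mod_]_ : ℕ → ℕ → ℕ → Set
y ≡[mod k ] y' = k ∣ ∣ y - y' ∣

AdjG : ℕ → ℕ × ℕ → ℕ × ℕ → Set
AdjG k (x , y) (x' , y') =
  (x ≡ x' × diff1 y y') ⊎ (¬ x ≡ x' × ¬ (y ≡[mod k ] y'))

dist-sym : ∀ y y' → ∣ y - y' ∣ ≡ ∣ y' - y ∣
dist-sym zero zero = refl
dist-sym zero (suc y') = refl
dist-sym (suc y) zero = refl
dist-sym (suc y) (suc y') = dist-sym y y'

AdjG-sym : ∀ k {a b} → AdjG k a b → AdjG k b a
AdjG-sym k (inj₁ (p , q)) = inj₁ (sym p , diff1-sym q)
AdjG-sym k {x , y} {x' , y'} (inj₂ (p , q)) =
  inj₂ ((λ e → p (sym e)) , λ d → q (subst' (dist-sym y' y) d))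
  where subst' : ∀ {a b} → a ≡ b → k ∣ a → k ∣ b
        subst' refl d = d

AdjG-irr : ∀ k {a} → ¬ AdjG k a a
AdjG-irr k {x , y} (inj₁ (_ , q)) = diff1-irr {y} q
AdjG-irr k (inj₂ (p , _)) = p refl

Ghat : ℕ → Graph
Ghat k = record
  { V = ℕ × ℕ ; Adj = AdjG k ; sym' = AdjG-sym k ; irrefl = λ {a} → AdjG-irr k {a} }

Qhat : ℕ → Graph
Qhat k = Induced (Ghat k) (λ p → proj₂ p < proj₁ p + 5)

module Submission where

-- In an induced path of Ĝ_k an edge that changes column joins vertices differing both in
-- column and in residue mod k, and every vertex of an edge at distance at least 3 agrees with
-- each of its ends in column or residue; this forces that edge to be the "transpose" of the
-- first one, so no three column changes can be pairwise far apart.  Every long induced path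
-- therefore contains a long vertical run, along which the height moves monotonically by one.
--
-- Path-minimality: an induced subgraph of Q̂_k with arbitrarily long paths thus contains
-- vertical segments of every length; taking them in ever later columns and shifting each to
-- start at a multiple of k gives a copy of Q̂_k, as adjacency only depends on equality of
-- columns, on vertical distance and on residues mod k.
--
-- Incomparability: a long path plus an apex adjacent to the path vertices of index not
-- divisible by k embeds in Q̂_k (path up a column, apex in the next one).  In Q̂_k' the path
-- contains a long vertical run; the apex cannot share its column (it would have three
-- vertical neighbours), and otherwise the run indices divisible by k are exactly those whose
-- height has the residue of the apex mod k'; as heights move by one, k' ∣ k and k ∣ k'.

open import Defs
open import Data.Nat
  using (ℕ; zero; suc; _+_; _*_; _∸_; _≤_; _<_; z≤n; s≤s; z<s; NonZero; ∣_-_∣; _%_; _/_; _≟_; anyUpTo?)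
open import Data.Nat.Properties
open import Data.Nat.DivMod using (m≡m%n+[m/n]*n; %-remove-+ʳ; %-remove-+ˡ; m%n≤n)
open import Data.Nat.Divisibility
  using (_∣_; divides; _∣?_; _∣0; ∣-refl; ∣-antisym; ∣m+n∣m⇒∣n; ∣m∣n⇒∣m+n; ∣1⇒≡1)
open import Data.Fin using (Fin; toℕ; fromℕ<) renaming (zero to fzero; suc to fsuc)
open import Data.Fin.Properties using (toℕ-injective; toℕ-fromℕ<; toℕ≤pred[n])
import Data.Fin.Properties as Fin
open import Data.Product using (Σ; _×_; _,_; proj₁; proj₂)
open import Data.Sum using (_⊎_; inj₁; inj₂)
open import Data.Empty using (⊥; ⊥-elim)
open import Function using (id)
open import Relation.Nullary using (¬_; yes; no; ¬?)
open import Relation.Nullary.Decidable using (decidable-stable)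
open import Relation.Binary.PropositionalEquality
  using (_≡_; _≢_; refl; sym; trans; cong; cong₂; subst; subst₂; module ≡-Reasoning)
open import Relation.Binary.Definitions using (tri<; tri≈; tri>)

module _ (k : ℕ) .{{_ : NonZero k}} where

  %≡⇒≡[mod] : ∀ y y' → y % k ≡ y' % k → y ≡[mod k ] y'
  %≡⇒≡[mod] y y' eq = divides ∣ q - q' ∣ (begin
    ∣ y - y' ∣                           ≡⟨ cong₂ ∣_-_∣ (m≡m%n+[m/n]*n y k) (m≡m%n+[m/n]*n y' k) ⟩
    ∣ y % k + q * k - y' % k + q' * k ∣  ≡⟨ cong (λ r → ∣ r + q * k - y' % k + q' * k ∣) eq ⟩
    ∣ y' % k + q * k - y' % k + q' * k ∣ ≡⟨ ∣m+n-m+o∣≡∣n-o∣ (y' % k) (q * k) (q' * k) ⟩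
    ∣ q * k - q' * k ∣                   ≡⟨ sym (*-distribʳ-∣-∣ k q q') ⟩
    ∣ q - q' ∣ * k                       ∎)
    where
      open ≡-Reasoning
      q q' : ℕ
      q  = y / k
      q' = y' / k

  private
    ≤∧≡[mod]⇒%≡ : ∀ {y y'} → y ≤ y' → y ≡[mod k ] y' → y % k ≡ y' % k
    ≤∧≡[mod]⇒%≡ {y} {y'} y≤y' k∣ = begin
      y % k                ≡⟨ sym (%-remove-+ʳ y (subst (k ∣_) (m≤n⇒∣m-n∣≡n∸m y≤y') k∣)) ⟩
      (y + (y' ∸ y)) % k   ≡⟨ cong (_% k) (m+[n∸m]≡n y≤y') ⟩
      y' % k               ∎
      where open ≡-Reasoning

  ≡[mod]⇒%≡ : ∀ y y' → y ≡[mod k ] y' → y % k ≡ y' % k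
  ≡[mod]⇒%≡ y y' k∣ with ≤-total y y'
  ... | inj₁ y≤y' = ≤∧≡[mod]⇒%≡ y≤y' k∣
  ... | inj₂ y'≤y = sym (≤∧≡[mod]⇒%≡ y'≤y (subst (k ∣_) (∣-∣-comm y y') k∣))

  -- a full k, not 0, when b is already a multiple of k
  toMultiple : ℕ → ℕ
  toMultiple b = k ∸ b % k

  toMultiple≤ : ∀ b → toMultiple b ≤ k
  toMultiple≤ b = m∸n≤m k (b % k)

  ∣+toMultiple : ∀ b → k ∣ b + toMultiple b
  ∣+toMultiple b = divides (suc (b / k)) (begin
    b + (k ∸ b % k)                  ≡⟨ cong (_+ (k ∸ b % k)) (m≡m%n+[m/n]*n b k) ⟩
    b % k + b / k * k + (k ∸ b % k)  ≡⟨ cong (_+ (k ∸ b % k)) (+-comm (b % k) (b / k * k)) ⟩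
    b / k * k + b % k + (k ∸ b % k)  ≡⟨ +-assoc (b / k * k) (b % k) (k ∸ b % k) ⟩
    b / k * k + (b % k + (k ∸ b % k)) ≡⟨ cong (b / k * k +_) (m+[n∸m]≡n (m%n≤n b k)) ⟩
    b / k * k + k                    ≡⟨ +-comm (b / k * k) k ⟩
    suc (b / k) * k                  ∎)
    where open ≡-Reasoning

diff1-+ˡ : ∀ b {y y'} → diff1 y y' → diff1 (b + y) (b + y')
diff1-+ˡ b {y} {y'} (inj₁ e) = inj₁ (trans (cong (b +_) e) (+-suc b y'))
diff1-+ˡ b {y} {y'} (inj₂ e) = inj₂ (trans (cong (b +_) e) (+-suc b y))

diff1-cancelˡ : ∀ b {y y'} → diff1 (b + y) (b + y') → diff1 y y'
diff1-cancelˡ b {y} {y'} (inj₁ e) = inj₁ (+-cancelˡ-≡ b _ _ (trans e (sym (+-suc b y'))))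
diff1-cancelˡ b {y} {y'} (inj₂ e) = inj₂ (+-cancelˡ-≡ b _ _ (trans e (sym (+-suc b y))))

¬diff1-distant : ∀ {i j} → 2 + i ≤ j → ¬ diff1 i j
¬diff1-distant {j = j} 2+i≤j (inj₁ refl) = 1+n≰n (≤-trans (m≤n+m (suc j) 2) 2+i≤j)
¬diff1-distant 2+i≤j (inj₂ refl) = 1+n≰n (≤-pred 2+i≤j)

diff1-three : ∀ {z a b c} → diff1 z a → diff1 z b → diff1 z c → a ≢ b → a ≢ c → b ≢ c → ⊥
diff1-three (inj₁ p) (inj₁ q) _ a≢b _ _ = a≢b (suc-injective (trans (sym p) q))
diff1-three (inj₂ p) (inj₂ q) _ a≢b _ _ = a≢b (trans p (sym q))
diff1-three (inj₁ p) _ (inj₁ q) _ a≢c _ = a≢c (suc-injective (trans (sym p) q))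
diff1-three (inj₂ p) _ (inj₂ q) _ a≢c _ = a≢c (trans p (sym q))
diff1-three _ (inj₁ p) (inj₁ q) _ _ b≢c = b≢c (suc-injective (trans (sym p) q))
diff1-three _ (inj₂ p) (inj₂ q) _ _ b≢c = b≢c (trans p (sym q))

Ascending Descending : (ℕ → ℕ) → ℕ → Set
Ascending  Y L = ∀ j → j < L → Y (suc j) ≡ suc (Y j)
Descending Y L = ∀ j → j < L → Y j ≡ suc (Y (suc j))

Monotone : (ℕ → ℕ) → ℕ → Set
Monotone Y L = Ascending Y L ⊎ Descending Y L

unit-steps⇒monotone : ∀ Y L →
  (∀ j → j < L → diff1 (Y j) (Y (suc j))) →
  (∀ j → 2 + j ≤ L → Y j ≢ Y (2 + j)) →
  Monotone Y L
unit-steps⇒monotone Y zero step no-return = inj₁ λ _ ()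
unit-steps⇒monotone Y (suc L) step no-return with step 0 z<s
... | inj₂ up   = inj₁ ascend
  where
    ascend : Ascending Y (suc L)
    ascend zero    _     = up
    ascend (suc j) 2+j≤ with step (suc j) 2+j≤
    ... | inj₂ e = e
    ... | inj₁ e = ⊥-elim (no-return j 2+j≤
                     (suc-injective (trans (sym (ascend j (≤-trans (n≤1+n _) 2+j≤))) e)))
... | inj₁ down = inj₂ descend
  where
    descend : Descending Y (suc L)
    descend zero    _     = down
    descend (suc j) 2+j≤ with step (suc j) 2+j≤
    ... | inj₁ e = e
    ... | inj₂ e = ⊥-elim (no-return j 2+j≤ (trans (descend j (≤-trans (n≤1+n _) 2+j≤)) (sym e)))

increasing⇒<-mono : (f : ℕ → ℕ) → (∀ n → f n < f (suc n)) → ∀ {n n'} → n < n' → f n < f n'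
increasing⇒<-mono f inc {n} {suc n'} n<1+n' with m<1+n⇒m<n∨m≡n n<1+n'
... | inj₁ n<n' = <-trans (increasing⇒<-mono f inc n<n') (inc n')
... | inj₂ refl = inc n

increasing⇒injective : (f : ℕ → ℕ) → (∀ n → f n < f (suc n)) → ∀ {n n'} → f n ≡ f n' → n ≡ n'
increasing⇒injective f inc {n} {n'} eq with <-cmp n n'
... | tri< n<n' _ _ = ⊥-elim (<⇒≢ (increasing⇒<-mono f inc n<n') eq)
... | tri≈ _ n≡n' _ = n≡n'
... | tri> _ _ n'<n = ⊥-elim (<⇒≢ (increasing⇒<-mono f inc n'<n) (sym eq))

ascending-shift : ∀ {Y L} → Ascending Y L → ∀ u d → u + d ≤ L → Y (u + d) ≡ Y u + d
ascending-shift {Y} asc u zero    _ = trans (cong Y (+-identityʳ u)) (sym (+-identityʳ (Y u)))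
ascending-shift {Y} {L} asc u (suc d) h = begin
  Y (u + suc d)     ≡⟨ cong Y (+-suc u d) ⟩
  Y (suc (u + d))   ≡⟨ asc (u + d) (subst (_≤ L) (+-suc u d) h) ⟩
  suc (Y (u + d))   ≡⟨ cong suc (ascending-shift asc u d (≤-trans (+-monoʳ-≤ u (n≤1+n d)) h)) ⟩
  suc (Y u + d)     ≡⟨ sym (+-suc (Y u) d) ⟩
  Y u + suc d       ∎
  where open ≡-Reasoning

descending-shift : ∀ {Y L} → Descending Y L → ∀ u d → u + d ≤ L → Y u ≡ Y (u + d) + d
descending-shift {Y} desc u zero    _ = trans (cong Y (sym (+-identityʳ u))) (sym (+-identityʳ _))
descending-shift {Y} {L} desc u (suc d) h = begin
  Y u                   ≡⟨ descending-shift desc u d (≤-trans (+-monoʳ-≤ u (n≤1+n d)) h) ⟩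
  Y (u + d) + d         ≡⟨ cong (_+ d) (desc (u + d) (subst (_≤ L) (+-suc u d) h)) ⟩
  suc (Y (suc (u + d))) + d ≡⟨ cong (λ i → suc (Y i) + d) (sym (+-suc u d)) ⟩
  suc (Y (u + suc d)) + d   ≡⟨ sym (+-suc (Y (u + suc d)) d) ⟩
  Y (u + suc d) + suc d ∎
  where open ≡-Reasoning

monotone-distance : ∀ {Y L} → Monotone Y L → ∀ u d → u + d ≤ L → ∣ Y u - Y (u + d) ∣ ≡ d
monotone-distance {Y} (inj₁ asc) u d h rewrite ascending-shift asc u d h = ∣m-m+n∣≡n (Y u) d
monotone-distance {Y} (inj₂ desc) u d h rewrite descending-shift desc u d h =
  trans (∣-∣-comm (Y (u + d) + d) (Y (u + d))) (∣m-m+n∣≡n (Y (u + d)) d)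

monotone-<⇒≢ : ∀ {Y L} → Monotone Y L → ∀ {i i'} → i < i' → i' ≤ L → Y i ≢ Y i'
monotone-<⇒≢ {Y} {L} mono {i} {i'} i<i' i'≤L eq = <⇒≢ (m<n⇒0<n∸m i<i') (begin
  0                        ≡⟨ sym (∣n-n∣≡0 (Y i)) ⟩
  ∣ Y i - Y i ∣            ≡⟨ cong (λ y → ∣ Y i - y ∣) (trans eq (cong Y (sym i+[i'∸i]≡i'))) ⟩
  ∣ Y i - Y (i + (i' ∸ i)) ∣ ≡⟨ monotone-distance mono i (i' ∸ i) (≤-trans (≤-reflexive i+[i'∸i]≡i') i'≤L) ⟩
  i' ∸ i                   ∎)
  where
    open ≡-Reasoning
    i+[i'∸i]≡i' : i + (i' ∸ i) ≡ i'
    i+[i'∸i]≡i' = m+[n∸m]≡n (<⇒≤ i<i')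

monotone⇒interval : ∀ {Y L} → Monotone Y L →
  Σ (ℕ → ℕ) λ ι → ∀ j → j ≤ L → ι j ≤ L × Y (ι j) ≡ Y (ι 0) + j
monotone⇒interval (inj₁ asc) = id , λ j j≤L → j≤L , ascending-shift asc 0 j j≤L
monotone⇒interval {Y} {L} (inj₂ desc) = (L ∸_) , λ j j≤L →
  m∸n≤m L j ,
  trans (descending-shift desc (L ∸ j) j (≤-reflexive (m∸n+n≡m j≤L)))
        (cong (λ i → Y i + j) (m∸n+n≡m j≤L))

-- Induced matchings in tensor products of complete graphs (adjacency is Apart)

module _ {A B : Set} where

  Apart Aligned : A × B → A × B → Set
  Apart   (a , x) (b , y) = a ≢ b × x ≢ y
  Aligned (a , x) (b , y) = a ≡ b ⊎ x ≡ y

  AlignedEdges : (A × B) × (A × B) → (A × B) × (A × B) → Set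
  AlignedEdges (u , v) (u' , v') = Aligned u u' × Aligned u v' × Aligned v u' × Aligned v v'

  transpose : (A × B) × (A × B) → (A × B) × (A × B)
  transpose ((a , x) , (b , y)) = (a , y) , (b , x)

  apart⇒¬aligned : ∀ {u v} → Apart u v → ¬ Aligned u v
  apart⇒¬aligned (a≢b , _) (inj₁ a≡b) = a≢b a≡b
  apart⇒¬aligned (_ , x≢y) (inj₂ x≡y) = x≢y x≡y

  aligned-with-apart-ends : ∀ {a x u' v'} → Apart u' v' → Aligned (a , x) u' → Aligned (a , x) v' →
    (a ≡ proj₁ u' × x ≡ proj₂ v') ⊎ (x ≡ proj₂ u' × a ≡ proj₁ v')
  aligned-with-apart-ends (a'≢b' , _)  (inj₁ p) (inj₁ q) = ⊥-elim (a'≢b' (trans (sym p) q))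
  aligned-with-apart-ends _            (inj₁ p) (inj₂ q) = inj₁ (p , q)
  aligned-with-apart-ends _            (inj₂ p) (inj₁ q) = inj₂ (p , q)
  aligned-with-apart-ends (_ , x'≢y')  (inj₂ p) (inj₂ q) = ⊥-elim (x'≢y' (trans (sym p) q))

  aligned-edges⇒transposed : ∀ {u v u' v'} → Apart u v → Apart u' v' → AlignedEdges (u , v) (u' , v') →
    (u' , v') ≡ transpose (u , v) ⊎ (v' , u') ≡ transpose (u , v)
  aligned-edges⇒transposed {u' = u'} {v'} (a≢b , x≢y) apart' (uu' , uv' , vu' , vv')
    with aligned-with-apart-ends apart' uu' uv' | aligned-with-apart-ends apart' vu' vv'
  ... | inj₁ (refl , _)    | inj₁ (b≡a' , _)    = ⊥-elim (a≢b (sym b≡a'))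
  ... | inj₁ (refl , refl) | inj₂ (refl , refl) = inj₁ refl
  ... | inj₂ (refl , refl) | inj₁ (refl , refl) = inj₂ refl
  ... | inj₂ (refl , _)    | inj₂ (y≡x' , _)    = ⊥-elim (x≢y (sym y≡x'))

  no-induced-3-matching : ∀ {u₁ v₁ u₂ v₂ u₃ v₃} → Apart u₁ v₁ → Apart u₂ v₂ → Apart u₃ v₃ →
    AlignedEdges (u₁ , v₁) (u₂ , v₂) → AlignedEdges (u₁ , v₁) (u₃ , v₃) →
    AlignedEdges (u₂ , v₂) (u₃ , v₃) → ⊥
  no-induced-3-matching apart₁ apart₂ apart₃ al₁₂ al₁₃ al₂₃
    with aligned-edges⇒transposed apart₁ apart₂ al₁₂ | aligned-edges⇒transposed apart₁ apart₃ al₁₃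
  ... | inj₁ refl | inj₁ refl = apart⇒¬aligned apart₂ (proj₁ (proj₂ al₂₃))
  ... | inj₁ refl | inj₂ refl = apart⇒¬aligned apart₂ (proj₁ al₂₃)
  ... | inj₂ refl | inj₁ refl = apart⇒¬aligned apart₂ (proj₁ al₂₃)
  ... | inj₂ refl | inj₂ refl = apart⇒¬aligned apart₂ (proj₁ (proj₂ al₂₃))

-- Adjacency in Ĝ_k: a path in each column, a tensor product (via label) across columns

module _ {k : ℕ} .{{_ : NonZero k}} where

  label : ℕ × ℕ → ℕ × ℕ
  label (x , y) = x , y % k

  AdjG-same-column : ∀ {u v} → proj₁ u ≡ proj₁ v → AdjG k u v → diff1 (proj₂ u) (proj₂ v)
  AdjG-same-column _   (inj₁ (_ , d))    = d
  AdjG-same-column x≡x' (inj₂ (x≢x' , _)) = ⊥-elim (x≢x' x≡x')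

  AdjG-across⇒apart : ∀ {u v} → proj₁ u ≢ proj₁ v → AdjG k u v → Apart (label u) (label v)
  AdjG-across⇒apart x≢x' (inj₁ (x≡x' , _)) = ⊥-elim (x≢x' x≡x')
  AdjG-across⇒apart {_ , y} {_ , y'} _ (inj₂ (x≢x' , y≢y')) =
    x≢x' , λ r≡r' → y≢y' (%≡⇒≡[mod] k y y' r≡r')

  apart⇒AdjG : ∀ {u v} → Apart (label u) (label v) → AdjG k u v
  apart⇒AdjG {_ , y} {_ , y'} (x≢x' , r≢r') =
    inj₂ (x≢x' , λ y≡y' → r≢r' (≡[mod]⇒%≡ k y y' y≡y'))

  ¬AdjG⇒aligned : ∀ {u v} → ¬ AdjG k u v → Aligned (label u) (label v)
  ¬AdjG⇒aligned {x , y} {x' , y'} ¬adj with x ≟ x' | y % k ≟ y' % k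
  ... | yes x≡x' | _        = inj₁ x≡x'
  ... | no _     | yes r≡r' = inj₂ r≡r'
  ... | no x≢x'  | no r≢r'  = ⊥-elim (¬adj (apart⇒AdjG (x≢x' , r≢r')))

module Relabelling {k : ℕ} .{{_ : NonZero k}} (C B : ℕ → ℕ)
  (C-injective : ∀ {n n'} → C n ≡ C n' → n ≡ n') (k∣B : ∀ n → k ∣ B n) where

  relabel : ℕ × ℕ → ℕ × ℕ
  relabel (n , y) = C n , B n + y

  label-relabel : ∀ n y → label (relabel (n , y)) ≡ (C n , y % k)
  label-relabel n y = cong (C n ,_) (%-remove-+ˡ y (k∣B n))

  relabel-injective : ∀ {u v} → relabel u ≡ relabel v → u ≡ v
  relabel-injective {n , y} {n' , y'} eq with C-injective (cong proj₁ eq)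
  ... | refl = cong (n ,_) (+-cancelˡ-≡ (B n) y y' (cong proj₂ eq))

  relabel-pres : ∀ {u v} → AdjG k u v → AdjG k (relabel u) (relabel v)
  relabel-pres {n , _} (inj₁ (refl , d)) = inj₁ (refl , diff1-+ˡ (B n) d)
  relabel-pres {n , y} {n' , y'} adj@(inj₂ (n≢n' , _)) = apart⇒AdjG (subst₂ Apart
    (sym (label-relabel n y)) (sym (label-relabel n' y'))
    ((λ e → n≢n' (C-injective e)) , proj₂ (AdjG-across⇒apart n≢n' adj)))

  relabel-refl : ∀ {u v} → AdjG k (relabel u) (relabel v) → AdjG k u v
  relabel-refl {n , y} {n' , y'} adj with n ≟ n'
  ... | yes refl = inj₁ (refl , diff1-cancelˡ (B n) (AdjG-same-column refl adj))
  ... | no n≢n'  = apart⇒AdjG (n≢n' , proj₂ (subst₂ Apart (label-relabel n y) (label-relabel n' y')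
                     (AdjG-across⇒apart (λ e → n≢n' (C-injective e)) adj)))

-- Induced paths and their vertical runs

_∘ᴱ_ : ∀ {F G H} → Embedding G H → Embedding F G → Embedding F H
e ∘ᴱ d = record
  { f     = λ a → Embedding.f e (Embedding.f d a)
  ; inj   = λ eq → Embedding.inj d (Embedding.inj e eq)
  ; pres  = λ adj → Embedding.pres e (Embedding.pres d adj)
  ; refl' = λ adj → Embedding.refl' d (Embedding.refl' e adj)
  }

clamp : (m : ℕ) → ℕ → Fin (suc m)
clamp m i = fromℕ< (s≤s (m⊓n≤n i m))

toℕ-clamp : ∀ {m i} → i ≤ m → toℕ (clamp m i) ≡ i
toℕ-clamp i≤m = trans (toℕ-fromℕ< _) (m≤n⇒m⊓n≡m i≤m)

-- the values of at beyond m are junk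
record InducedPath (k m : ℕ) : Set where
  field
    at   : ℕ → ℕ × ℕ
    adj  : ∀ {i j} → i ≤ m → j ≤ m → diff1 i j → AdjG k (at i) (at j)
    nadj : ∀ {i j} → i ≤ m → j ≤ m → AdjG k (at i) (at j) → diff1 i j

embedded-path : ∀ {k m G} (e : Embedding (PathGraph m) G) (π : V G → ℕ × ℕ) →
  (∀ {a b} → Adj G a b → AdjG k (π a) (π b)) → (∀ {a b} → AdjG k (π a) (π b) → Adj G a b) →
  InducedPath k m
embedded-path {m = m} e π π-pres π-refl = record
  { at   = λ i → π (Embedding.f e (clamp m i))
  ; adj  = λ i≤m j≤m d →
      π-pres (Embedding.pres e (subst₂ diff1 (sym (toℕ-clamp i≤m)) (sym (toℕ-clamp j≤m)) d))
  ; nadj = λ i≤m j≤m adj →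
      subst₂ diff1 (toℕ-clamp i≤m) (toℕ-clamp j≤m) (Embedding.refl' e (π-refl adj))
  }

-- three windows of length L separated by gaps of 3, one of which holds a vertical run
runThreshold : ℕ → ℕ
runThreshold L = L + 3 + L + 3 + L

3≤runThreshold : ∀ L → 3 ≤ runThreshold L
3≤runThreshold L = ≤-trans (m≤n+m 3 L) (≤-trans (m≤m+n _ L) (≤-trans (m≤m+n _ 3) (m≤m+n _ L)))

windows-apart : ∀ s {L n n'} → n < L → 3 + (s + n) ≤ s + L + 3 + n'
windows-apart s {L} {n} {n'} n<L = ≤-trans (≤-reflexive (+-comm 3 (s + n)))
  (≤-trans (+-monoˡ-≤ 3 (+-monoʳ-≤ s (<⇒≤ n<L))) (m≤m+n _ n'))

module _ {k m : ℕ} .{{_ : NonZero k}} (path : InducedPath k m) where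
  open InducedPath path

  column height : ℕ → ℕ
  column i = proj₁ (at i)
  height i = proj₂ (at i)

  Turn : ℕ → Set
  Turn i = column i ≢ column (suc i)

  edge : ℕ → (ℕ × ℕ) × (ℕ × ℕ)
  edge i = label (at i) , label (at (suc i))

  turn⇒apart : ∀ {i} → suc i ≤ m → Turn i → Apart (label (at i)) (label (at (suc i)))
  turn⇒apart i<m turn = AdjG-across⇒apart turn (adj (<⇒≤ i<m) i<m (inj₂ refl))

  distant⇒aligned : ∀ {i j} → 2 + i ≤ j → j ≤ m → Aligned (label (at i)) (label (at j))
  distant⇒aligned 2+i≤j j≤m = ¬AdjG⇒aligned λ a →
    ¬diff1-distant 2+i≤j (nadj (≤-trans (m≤n+m _ 2) (≤-trans 2+i≤j j≤m)) j≤m a)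

  distant-edges-aligned : ∀ {i j} → 3 + i ≤ j → suc j ≤ m → AlignedEdges (edge i) (edge j)
  distant-edges-aligned 3+i≤j j<m =
    distant⇒aligned (≤-trans (n≤1+n _) 3+i≤j) j≤m ,
    distant⇒aligned (≤-trans (n≤1+n _) (m≤n⇒m≤1+n 3+i≤j)) j<m ,
    distant⇒aligned 3+i≤j j≤m ,
    distant⇒aligned (m≤n⇒m≤1+n 3+i≤j) j<m
    where
      j≤m : _ ≤ m
      j≤m = <⇒≤ j<m

  no-three-distant-turns : ∀ {i₁ i₂ i₃} → Turn i₁ → Turn i₂ → Turn i₃ →
    3 + i₁ ≤ i₂ → 3 + i₂ ≤ i₃ → suc i₃ ≤ m → ⊥
  no-three-distant-turns {i₁} {i₂} turn₁ turn₂ turn₃ i₁⋯i₂ i₂⋯i₃ i₃<m =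
    no-induced-3-matching
      (turn⇒apart i₁<m turn₁) (turn⇒apart i₂<m turn₂) (turn⇒apart i₃<m turn₃)
      (distant-edges-aligned i₁⋯i₂ i₂<m)
      (distant-edges-aligned (≤-trans i₁⋯i₂ (≤-trans (m≤n+m _ 3) i₂⋯i₃)) i₃<m)
      (distant-edges-aligned i₂⋯i₃ i₃<m)
    where
      i₂<m : suc i₂ ≤ m
      i₂<m = ≤-trans (m≤n+m _ 2) (≤-trans i₂⋯i₃ (<⇒≤ i₃<m))
      i₁<m : suc i₁ ≤ m
      i₁<m = ≤-trans (m≤n+m _ 2) (≤-trans i₁⋯i₂ (<⇒≤ i₂<m))

  no-backtrack : 3 ≤ m → ∀ {i j} → j ≡ 2 + i → j ≤ m → at i ≢ at j
  no-backtrack 3≤m {zero} refl _ at₀≡at₂ = ¬diff1-distant {0} {3} (n≤1+n 2)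
    (nadj z≤n 3≤m (subst (λ v → AdjG k v (at 3)) (sym at₀≡at₂)
      (adj (≤-trans (n≤1+n 2) 3≤m) 3≤m (inj₂ refl))))
  no-backtrack _ {suc i} refl 3+i≤m at₁₊ᵢ≡at₃₊ᵢ = ¬diff1-distant {i} {3 + i} (n≤1+n _)
    (nadj i≤m 3+i≤m (subst (AdjG k (at i)) at₁₊ᵢ≡at₃₊ᵢ
      (adj i≤m (≤-trans (m≤n+m _ 2) 3+i≤m) (inj₂ refl))))
    where
      i≤m : i ≤ m
      i≤m = ≤-trans (m≤n+m i 3) 3+i≤m

  record VerticalRun (L : ℕ) : Set where
    field
      start vertical : ℕ
      fits           : start + L ≤ m
      in-column      : ∀ j → j ≤ L → column (start + j) ≡ vertical
      monotone       : Monotone (λ j → height (start + j)) L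

  steady⇒run : 3 ≤ m → ∀ s L → s + L ≤ m → (∀ n → n < L → column (s + n) ≡ column (suc (s + n))) →
    VerticalRun L
  steady⇒run 3≤m s L fits steady = record
    { start = s ; vertical = column (s + 0) ; fits = fits ; in-column = in-column
    ; monotone = unit-steps⇒monotone (λ j → height (s + j)) L unit-step no-return }
    where
      index≤m : ∀ {j} → j ≤ L → s + j ≤ m
      index≤m j≤L = ≤-trans (+-monoʳ-≤ s j≤L) fits

      in-column : ∀ j → j ≤ L → column (s + j) ≡ column (s + 0)
      in-column zero    _   = refl
      in-column (suc j) j<L =
        trans (cong column (+-suc s j)) (trans (sym (steady j j<L)) (in-column j (<⇒≤ j<L)))

      same-column : ∀ {j j'} → j ≤ L → j' ≤ L → column (s + j) ≡ column (s + j')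
      same-column j≤L j'≤L = trans (in-column _ j≤L) (sym (in-column _ j'≤L))

      unit-step : ∀ j → j < L → diff1 (height (s + j)) (height (s + suc j))
      unit-step j j<L = AdjG-same-column (same-column (<⇒≤ j<L) j<L)
        (adj (index≤m (<⇒≤ j<L)) (index≤m j<L) (inj₂ (+-suc s j)))

      no-return : ∀ j → 2 + j ≤ L → height (s + j) ≢ height (s + (2 + j))
      no-return j 2+j≤L h≡h = no-backtrack 3≤m
        (trans (+-suc s (suc j)) (cong suc (+-suc s j))) (index≤m 2+j≤L)
        (cong₂ _,_ (same-column (≤-trans (m≤n+m j 2) 2+j≤L) 2+j≤L) h≡h)

  TurnIn : ℕ → ℕ → Set
  TurnIn s L = Σ ℕ λ n → n < L × Turn (s + n)

  turn-or-run : 3 ≤ m → ∀ s L → s + L ≤ m → TurnIn s L ⊎ VerticalRun L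
  turn-or-run 3≤m s L fits with anyUpTo? (λ n → ¬? (column (s + n) ≟ column (suc (s + n)))) L
  ... | yes turn = inj₁ turn
  ... | no ¬turn = inj₂ (steady⇒run 3≤m s L fits λ n n<L →
                     decidable-stable (column (s + n) ≟ column (suc (s + n))) (λ t → ¬turn (n , n<L , t)))

  -- opaque: only its fields are used, and unfolding it makes type checking blow up
  opaque
    vertical-run : ∀ L → runThreshold L ≤ m → VerticalRun L
    vertical-run L fits =
      first-run (window 0 (≤-trans (m≤n+m L _) fits))
                (window (L + 3) (≤-trans (≤-trans (m≤m+n _ 3) (m≤m+n _ L)) fits))
                (window (L + 3 + L + 3) fits)
      where
        window : ∀ s → s + L ≤ m → TurnIn s L ⊎ VerticalRun L
        window s = turn-or-run (≤-trans (3≤runThreshold L) fits) s L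

        first-run : TurnIn 0 L ⊎ VerticalRun L → TurnIn (L + 3) L ⊎ VerticalRun L →
          TurnIn (L + 3 + L + 3) L ⊎ VerticalRun L → VerticalRun L
        first-run (inj₂ run) _          _          = run
        first-run (inj₁ _)   (inj₂ run) _          = run
        first-run (inj₁ _)   (inj₁ _)   (inj₂ run) = run
        first-run (inj₁ (_ , n₁<L , turn₁)) (inj₁ (_ , n₂<L , turn₂)) (inj₁ (_ , n₃<L , turn₃)) =
          ⊥-elim (no-three-distant-turns turn₁ turn₂ turn₃
            (windows-apart 0 n₁<L) (windows-apart (L + 3) n₂<L) (≤-trans (+-monoʳ-< _ n₃<L) fits))

-- Path-minimality

Qhat-long-paths : ∀ k → HasArbitrarilyLongPaths (Qhat k)
Qhat-long-paths k n = n , ≤-refl , record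
  { f     = λ i → (n , toℕ i) , ≤-trans (s≤s (toℕ≤pred[n] i)) (m<m+n n z<s)
  ; inj   = λ eq → toℕ-injective (cong (λ v → proj₂ (proj₁ v)) eq)
  ; pres  = λ d → inj₁ (refl , d)
  ; refl' = λ { (inj₁ (_ , d)) → d ; (inj₂ (n≢n , _)) → ⊥-elim (n≢n refl) }
  }

module Minimality (k : ℕ) .{{_ : NonZero k}} (P : V (Qhat k) → Set)
  (long-paths : HasArbitrarilyLongPaths (Induced (Qhat k) P)) where

  X : Graph
  X = Induced (Qhat k) P

  coord : V X → ℕ × ℕ
  coord v = proj₁ (proj₁ v)

  record VerticalSegment (L : ℕ) : Set where
    field
      vertical base : ℕ
      point         : ℕ → V X
      coord-point   : ∀ j → j ≤ L → coord (point j) ≡ (vertical , base + j)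

  segment-of-path : ∀ {L m} → runThreshold L ≤ m → Embedding (PathGraph m) X → VerticalSegment L
  segment-of-path {L} {m} fits e = record
    { vertical = vertical ; base = height path (start + ι 0)
    ; point = λ j → Embedding.f e (clamp m (start + ι j))
    ; coord-point = λ j j≤L →
        cong₂ _,_ (in-column (ι j) (proj₁ (interval j j≤L))) (proj₂ (interval j j≤L)) }
    where
      path : InducedPath k m
      path = embedded-path e coord id id
      open VerticalRun (vertical-run path L fits)
      ι : ℕ → ℕ
      ι = proj₁ (monotone⇒interval monotone)
      interval : ∀ j → j ≤ L → ι j ≤ L × height path (start + ι j) ≡ height path (start + ι 0) + j
      interval = proj₂ (monotone⇒interval monotone)

  -- opaque: unfolding it while checking the chain below exhausts memory
  opaque
    segment : ∀ L → VerticalSegment L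
    segment L with long-paths (runThreshold L)
    ... | _ , fits , e = segment-of-path fits e

  segment-bound : ∀ {L} (S : VerticalSegment L) → VerticalSegment.base S + L < VerticalSegment.vertical S + 5
  segment-bound {L} S =
    subst (λ v → proj₂ v < proj₁ v + 5) (coord-point L ≤-refl) (proj₂ (proj₁ (point L)))
    where open VerticalSegment S

  -- Column n of Q̂_k is sent into the n-th segment of the chain: the segment has room for
  -- n + 5 vertices after a shift by at most k, and it is longer than the previous column
  -- index plus 5, which by segment-bound pushes it to a later column.
  floor : ℕ → ℕ
  chain : ∀ n → VerticalSegment (floor n + (k + (n + 4)))
  floor zero    = 0
  floor (suc n) = VerticalSegment.vertical (chain n) + 5
  chain n = segment _

  C base : ℕ → ℕ
  C n    = VerticalSegment.vertical (chain n)
  base n = VerticalSegment.base (chain n)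

  C-increasing : ∀ n → C n < C (suc n)
  C-increasing n = +-cancelʳ-< 5 (C n) (C (suc n)) (begin-strict
    C n + 5                                                ≤⟨ m≤m+n (C n + 5) _ ⟩
    floor (suc n) + (k + (suc n + 4))                      ≤⟨ m≤n+m _ (base (suc n)) ⟩
    base (suc n) + (floor (suc n) + (k + (suc n + 4)))     <⟨ segment-bound (chain (suc n)) ⟩
    C (suc n) + 5                                          ∎)
    where open ≤-Reasoning

  open Relabelling C (λ n → base n + toMultiple k (base n))
    (increasing⇒injective C C-increasing) (λ n → ∣+toMultiple k (base n))

  embedding : Embedding (Qhat k) X
  embedding = record
    { f     = ι
    ; inj   = ι-injective
    ; pres  = λ {a} {b} adj → subst₂ (AdjG k) (sym (coord-ι a)) (sym (coord-ι b)) (relabel-pres adj)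
    ; refl' = λ {a} {b} adj → relabel-refl (subst₂ (AdjG k) (coord-ι a) (coord-ι b) adj)
    }
    where
      ι : V (Qhat k) → V X
      ι ((n , y) , _) = VerticalSegment.point (chain n) (toMultiple k (base n) + y)

      coord-ι : ∀ v → coord (ι v) ≡ relabel (proj₁ v)
      coord-ι ((n , y) , y<n+5) =
        trans (VerticalSegment.coord-point (chain n) (toMultiple k (base n) + y) fits)
              (cong (C n ,_) (sym (+-assoc (base n) (toMultiple k (base n)) y)))
        where
          fits : toMultiple k (base n) + y ≤ floor n + (k + (n + 4))
          fits = ≤-trans (+-mono-≤ (toMultiple≤ k (base n)) (≤-pred (subst (y <_) (+-suc n 4) y<n+5)))
                         (m≤n+m _ (floor n))

      ι-injective : ∀ {a b} → ι a ≡ ι b → a ≡ b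
      ι-injective {u , p} {u' , p'} eq
        with relabel-injective {u} {u'} (trans (sym (coord-ι (u , p))) (trans (cong coord eq) (coord-ι (u' , p'))))
      ... | refl = cong (u ,_) (<-irrelevant p p')

-- Incomparability of the ages

ApexAdj : ∀ k N → Fin (2 + N) → Fin (2 + N) → Set
ApexAdj k N fzero    fzero    = ⊥
ApexAdj k N fzero    (fsuc j) = ¬ k ∣ toℕ j
ApexAdj k N (fsuc i) fzero    = ¬ k ∣ toℕ i
ApexAdj k N (fsuc i) (fsuc j) = diff1 (toℕ i) (toℕ j)

ApexAdj-sym : ∀ {k N a b} → ApexAdj k N a b → ApexAdj k N b a
ApexAdj-sym {a = fzero}  {fsuc _} k∤j = k∤j
ApexAdj-sym {a = fsuc _} {fzero}  k∤i = k∤i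
ApexAdj-sym {a = fsuc _} {fsuc _} d   = diff1-sym d

ApexAdj-irr : ∀ {k N a} → ¬ ApexAdj k N a a
ApexAdj-irr {a = fsuc i} d = diff1-irr {toℕ i} d

apexedPath : ℕ → ℕ → FiniteGraph
apexedPath k N = record
  { size = 2 + N ; Adjf = ApexAdj k N
  ; symf = λ {a} {b} → ApexAdj-sym {a = a} {b} ; irrf = λ {a} → ApexAdj-irr {a = a} }

path↪apexedPath : ∀ {k N} → Embedding (PathGraph N) (toGraph (apexedPath k N))
path↪apexedPath = record { f = fsuc ; inj = Fin.suc-injective ; pres = id ; refl' = id }

apexedPath∈age : ∀ k N → InAge (Qhat k) (apexedPath k N)
apexedPath∈age k N = record { f = place ; inj = place-injective ; pres = pres ; refl' = refl' }
  where
    place : Fin (2 + N) → V (Qhat k)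
    place fzero    = (suc N , 0) , s≤s z≤n
    place (fsuc i) = (N , toℕ i) , ≤-trans (s≤s (toℕ≤pred[n] i)) (m<m+n N z<s)

    place-injective : ∀ {a b} → place a ≡ place b → a ≡ b
    place-injective {fzero}  {fzero}  _  = refl
    place-injective {fzero}  {fsuc _} eq = ⊥-elim (1+n≢n (cong (λ v → proj₁ (proj₁ v)) eq))
    place-injective {fsuc _} {fzero}  eq = ⊥-elim (1+n≢n (cong (λ v → proj₁ (proj₁ v)) (sym eq)))
    place-injective {fsuc _} {fsuc _} eq = cong fsuc (toℕ-injective (cong (λ v → proj₂ (proj₁ v)) eq))

    apex-pres : ∀ {i} → ¬ k ∣ i → AdjG k (suc N , 0) (N , i)
    apex-pres k∤i = inj₂ (1+n≢n , k∤i)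

    apex-refl : ∀ {i} → AdjG k (suc N , 0) (N , i) → ¬ k ∣ i
    apex-refl (inj₁ (1+N≡N , _)) = ⊥-elim (1+n≢n 1+N≡N)
    apex-refl (inj₂ (_ , k∤i))   = k∤i

    pres : ∀ {a b} → ApexAdj k N a b → AdjG k (proj₁ (place a)) (proj₁ (place b))
    pres {fzero}  {fsuc _} k∤j = apex-pres k∤j
    pres {fsuc _} {fzero}  k∤i = AdjG-sym k (apex-pres k∤i)
    pres {fsuc _} {fsuc _} d   = inj₁ (refl , d)

    refl' : ∀ {a b} → AdjG k (proj₁ (place a)) (proj₁ (place b)) → ApexAdj k N a b
    refl' {fzero}  {fzero}  adj = AdjG-irr k adj
    refl' {fzero}  {fsuc _} adj = apex-refl adj
    refl' {fsuc _} {fzero}  adj = apex-refl (AdjG-sym k adj)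
    refl' {fsuc _} {fsuc _} (inj₁ (_ , d))    = d
    refl' {fsuc _} {fsuc _} (inj₂ (N≢N , _)) = ⊥-elim (N≢N refl)

¬∣suc : ∀ {k a} → 2 ≤ k → k ∣ a → ¬ k ∣ suc a
¬∣suc {k} {a} 2≤k k∣a k∣1+a =
  1+n≰n (subst (2 ≤_) (∣1⇒≡1 (∣m+n∣m⇒∣n (subst (k ∣_) (+-comm 1 a) k∣1+a) k∣a)) 2≤k)

module Incomparability (k k' : ℕ) .{{_ : NonZero k}} .{{_ : NonZero k'}} (2≤k : 2 ≤ k) where

  -- run offsets are j₀ + d with j₀ ≤ k and d ≤ spread
  spread L N : ℕ
  spread = suc (k + k) + k'
  L      = k + spread
  N      = runThreshold L

  module _ (E : InAge (Qhat k') (apexedPath k N)) where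

    path : InducedPath k' N
    path = embedded-path (E ∘ᴱ path↪apexedPath) proj₁ id id

    open InducedPath path
    open VerticalRun (vertical-run path L ≤-refl)

    apex : ℕ × ℕ
    apex = proj₁ (Embedding.f E fzero)

    Y : ℕ → ℕ
    Y j = height path (start + j)

    index≤N : ∀ {j} → j ≤ L → start + j ≤ N
    index≤N j≤L = ≤-trans (+-monoʳ-≤ start j≤L) fits

    apex-adj : ∀ {j} → j ≤ L → ¬ k ∣ start + j → AdjG k' apex (at (start + j))
    apex-adj j≤L k∤i = Embedding.pres E {fzero} {fsuc (clamp N _)}
      (λ k∣ → k∤i (subst (k ∣_) (toℕ-clamp (index≤N j≤L)) k∣))

    apex-nonadj : ∀ {j} → j ≤ L → k ∣ start + j → ¬ AdjG k' apex (at (start + j))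
    apex-nonadj j≤L k∣i adj = Embedding.refl' E {fzero} {fsuc (clamp N _)} adj
      (subst (k ∣_) (sym (toℕ-clamp (index≤N j≤L))) k∣i)

    j₀ : ℕ
    j₀ = toMultiple k start

    offset≤L : ∀ {d} → d ≤ spread → j₀ + d ≤ L
    offset≤L d≤ = +-mono-≤ (toMultiple≤ k start) d≤

    k∣start+j₀ : k ∣ start + j₀
    k∣start+j₀ = ∣+toMultiple k start

    offset-∣ : ∀ {d} → k ∣ d → k ∣ start + (j₀ + d)
    offset-∣ {d} k∣d = subst (k ∣_) (+-assoc start j₀ d) (∣m∣n⇒∣m+n k∣start+j₀ k∣d)

    offset-∤ : ∀ {d} → ¬ k ∣ d → ¬ k ∣ start + (j₀ + d)
    offset-∤ {d} k∤d k∣ = k∤d (∣m+n∣m⇒∣n (subst (k ∣_) (sym (+-assoc start j₀ d)) k∣) k∣start+j₀)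

    -- the apex would have three distinct vertical neighbours
    same-column-impossible : proj₁ apex ≡ vertical → ⊥
    same-column-impossible apex-col = diff1-three
      (neighbour d₁≤ (¬∣suc 2≤k (k ∣0)))
      (neighbour d₂≤ (¬∣suc 2≤k ∣-refl))
      (neighbour d₃≤ (¬∣suc 2≤k (∣m∣n⇒∣m+n ∣-refl ∣-refl)))
      (distinct d₁<d₂ d₂≤) (distinct (<-trans d₁<d₂ d₂<d₃) d₃≤) (distinct d₂<d₃ d₃≤)
      where
        neighbour : ∀ {d} → d ≤ spread → ¬ k ∣ d → diff1 (proj₂ apex) (Y (j₀ + d))
        neighbour d≤ k∤d = AdjG-same-column (trans apex-col (sym (in-column _ (offset≤L d≤))))
          (apex-adj (offset≤L d≤) (offset-∤ k∤d))

        distinct : ∀ {d d'} → d < d' → d' ≤ spread → Y (j₀ + d) ≢ Y (j₀ + d')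
        distinct d<d' d'≤ = monotone-<⇒≢ monotone (+-monoʳ-< j₀ d<d') (offset≤L d'≤)

        d₃≤ : suc (k + k) ≤ spread
        d₃≤ = m≤m+n _ k'
        d₂≤ : suc k ≤ spread
        d₂≤ = ≤-trans (s≤s (m≤m+n k k)) d₃≤
        d₁≤ : 1 ≤ spread
        d₁≤ = ≤-trans (s≤s z≤n) d₂≤
        d₁<d₂ : 1 < suc k
        d₁<d₂ = s≤s (≤-trans (n≤1+n 1) 2≤k)
        d₂<d₃ : suc k < suc (k + k)
        d₂<d₃ = s≤s (m<m+n k (≤-trans (n≤1+n 1) 2≤k))

    -- the run vertices at indices divisible by k are exactly those of the apex residue mod k'
    k≡k' : proj₁ apex ≢ vertical → k ≡ k'
    k≡k' apex-col = ∣-antisym k∣k' k'∣k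
      where
        residue : ∀ {j} → j ≤ L → k ∣ start + j → proj₂ apex % k' ≡ Y j % k'
        residue j≤L k∣i = aligned⇒same-residue j≤L (¬AdjG⇒aligned (apex-nonadj j≤L k∣i))
          where
            aligned⇒same-residue : ∀ {j} → j ≤ L → Aligned (label apex) (label (at (start + j))) →
              proj₂ apex % k' ≡ Y j % k'
            aligned⇒same-residue j≤L (inj₁ same-col) = ⊥-elim (apex-col (trans same-col (in-column _ j≤L)))
            aligned⇒same-residue _   (inj₂ same-res) = same-res

        k≤spread : k ≤ spread
        k≤spread = ≤-trans (≤-trans (m≤m+n k k) (n≤1+n _)) (m≤m+n _ k')

        k'≤spread : k' ≤ spread
        k'≤spread = m≤n+m k' _

        j₀≤L : j₀ ≤ L
        j₀≤L = ≤-trans (toMultiple≤ k start) (m≤m+n k spread)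

        k'∣k : k' ∣ k
        k'∣k = subst (k' ∣_) (monotone-distance monotone j₀ k (offset≤L k≤spread))
          (%≡⇒≡[mod] k' (Y j₀) (Y (j₀ + k))
            (trans (sym (residue j₀≤L k∣start+j₀)) (residue (offset≤L k≤spread) (offset-∣ ∣-refl))))

        k∣k' : k ∣ k'
        k∣k' = decidable-stable (k ∣? k') λ k∤k' →
          proj₂ (AdjG-across⇒apart (λ e → apex-col (trans e (in-column _ (offset≤L k'≤spread))))
                  (apex-adj (offset≤L k'≤spread) (offset-∤ k∤k')))
            (trans (residue j₀≤L k∣start+j₀)
              (≡[mod]⇒%≡ k' (Y j₀) (Y (j₀ + k'))
                (subst (k' ∣_) (sym (monotone-distance monotone j₀ k' (offset≤L k'≤spread))) ∣-refl)))

    apexedPath∈age⇒≡ : k ≡ k'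
    apexedPath∈age⇒≡ with proj₁ apex ≟ vertical
    ... | yes apex-col = ⊥-elim (same-column-impossible apex-col)
    ... | no  apex-col = k≡k' apex-col

Qhat-age-⊈ : ∀ {k k'} → 2 ≤ k → 2 ≤ k' → k ≢ k' → ¬ AgeSubset (Qhat k) (Qhat k')
Qhat-age-⊈ 2≤k@(s≤s (s≤s _)) (s≤s (s≤s _)) k≢k' ⊆ =
  k≢k' (Incomparability.apexedPath∈age⇒≡ _ _ 2≤k (⊆ _ (apexedPath∈age _ _)))

proposition4 : (∀ (k : ℕ) → 2 ≤ k → PathMinimal (Qhat k)) ×
    (∀ (k k' : ℕ) → 2 ≤ k → 2 ≤ k' → ¬ k ≡ k' →
    ¬ AgeSubset (Qhat k) (Qhat k') × ¬ AgeSubset (Qhat k') (Qhat k))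
proposition4 =
  (λ { k (s≤s (s≤s _)) → Qhat-long-paths k , Minimality.embedding k }) ,
  (λ k k' 2≤k 2≤k' k≢k' → Qhat-age-⊈ 2≤k 2≤k' k≢k' , Qhat-age-⊈ 2≤k' 2≤k (λ e → k≢k' (sym e)))
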